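{- For every integer $n\ge2$ and every $k=1,\dots,n-1$, $$P_n(x)=(1+x^2)^kP_{n-k}(x)+(1-x)\sum_{j=0}^{k-1}\mathcal{B}(n-j-1,0)(1+x^2)^jx^{n-j}.$$
   Context: For $0\le k\le n$ let $\mathcal{B}(n,k)=\binom{n}{\lfloor (n-k)/2\rfloor}$, so $\mathcal{B}(m,0)=\binom{m}{\lfloor m/2\rfloor}$, and let $P_n(x)=\sum_{k=0}^n\mathcal{B}(n,k)x^{n-k}$. -}

module Defs where

open import Level using (Level)
open import Data.Nat using (ℕ; zero; suc; _∸_)
open import Data.Nat.DivMod using (_/_)
open import Data.Nat.Combinatorics using (_C_)
open import Algebra.Bundles using (CommutativeRing; Semiring)

𝓑 : ℕ → ℕ → ℕ
𝓑 n k = n C ((n ∸ k) / 2)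

module _ {c ℓ : Level} (R : CommutativeRing c ℓ) where
  open CommutativeRing R
  open import Algebra.Definitions.RawSemiring (Semiring.rawSemiring semiring) using (_×_; _^_)

  ι : ℕ → Carrier
  ι n = n × 1#

  pow : Carrier → ℕ → Carrier
  pow x n = x ^ n

  sumBelow : ℕ → (ℕ → Carrier) → Carrier
  sumBelow zero    f = 0#
  sumBelow (suc m) f = sumBelow m f + f m

  P : ℕ → Carrier → Carrier
  P n x = sumBelow (suc n) (λ k → ι (𝓑 n k) * pow x (n ∸ k))

-- Written in ascending powers, P_n(x) = Σ_m C(n,⌊m/2⌋) x^m.  Pascal's rule
-- C(n+1,j+1) = C(n,j) + C(n,j+1) splits P_{n+1} into P_n plus x²·P_n with its top
-- term removed, and the top term C(n,⌈n/2⌉) x^{n+1} of P_{n+1} has the central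
-- coefficient C(n,⌊n/2⌋); this gives
--   P_{n+1} = (1+x²) P_n + (1-x) 𝓑(n,0) x^{n+1},
-- and unrolling the recursion k times yields the identity for every k ≤ n.
module Submission where

open import Defs
open import Level using (Level)
open import Data.Nat using (ℕ; zero; suc; _≤_; _<_; _∸_; z≤n; s≤s; ⌊_/2⌋; ⌈_/2⌉)
  renaming (_+_ to _+ℕ_)
open import Data.Nat.DivMod using (_/_; m/n≡1+[m∸n]/n)
open import Data.Nat.Combinatorics using (_C_; nCk≡nC[n∸k]; nCk+nC[k+1]≡[n+1]C[k+1])
open import Data.Nat.Properties
  using (⌊n/2⌋+⌈n/2⌉≡n; ⌈n/2⌉≤n; m+n∸n≡m; m∸n≤m; <⇒≤; ≤-trans)
open import Algebra.Bundles using (CommutativeRing)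
open import Relation.Binary.PropositionalEquality as ≡ using (_≡_; cong)

n/2≡⌊n/2⌋ : ∀ n → n / 2 ≡ ⌊ n /2⌋
n/2≡⌊n/2⌋ zero          = ≡.refl
n/2≡⌊n/2⌋ (suc zero)    = ≡.refl
n/2≡⌊n/2⌋ (suc (suc n)) =
  ≡.trans (m/n≡1+[m∸n]/n {suc (suc n)} {2} (s≤s (s≤s z≤n))) (cong suc (n/2≡⌊n/2⌋ n))

nC⌈n/2⌉≡nC⌊n/2⌋ : ∀ n → n C ⌈ n /2⌉ ≡ n C ⌊ n /2⌋
nC⌈n/2⌉≡nC⌊n/2⌋ n = ≡.trans (nCk≡nC[n∸k] (⌈n/2⌉≤n n)) (cong (n C_) n∸⌈n/2⌉≡⌊n/2⌋)
  where
  n∸⌈n/2⌉≡⌊n/2⌋ : n ∸ ⌈ n /2⌉ ≡ ⌊ n /2⌋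
  n∸⌈n/2⌉≡⌊n/2⌋ = ≡.trans (cong (_∸ ⌈ n /2⌉) (≡.sym (⌊n/2⌋+⌈n/2⌉≡n n))) (m+n∸n≡m ⌊ n /2⌋ ⌈ n /2⌉)

n<m⇒m∸n≡1+m∸[1+n] : ∀ {m n} → n < m → m ∸ n ≡ suc (m ∸ suc n)
n<m⇒m∸n≡1+m∸[1+n] {suc m} {zero}  _         = ≡.refl
n<m⇒m∸n≡1+m∸[1+n] {suc m} {suc n} (s≤s n<m) = n<m⇒m∸n≡1+m∸[1+n] n<m

module _ {c ℓ : Level} (R : CommutativeRing c ℓ) where
  open CommutativeRing R
  open import Algebra.Solver.Ring.NaturalCoefficients.Default commutativeSemiring
  open import Algebra.Properties.Monoid.Mult +-monoid using (×-homo-+)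
  open import Algebra.Properties.Ring ring using (-‿distribˡ-*)
  open import Relation.Binary.Reasoning.Setoid setoid

  private
    Σ< = sumBelow R
    _^_ = pow R

  sumBelow-cong : ∀ m {f g : ℕ → Carrier} → (∀ i → f i ≈ g i) → Σ< m f ≈ Σ< m g
  sumBelow-cong zero    f≈g = refl
  sumBelow-cong (suc m) f≈g = +-cong (sumBelow-cong m f≈g) (f≈g m)

  sumBelow-+ : ∀ m (f g : ℕ → Carrier) → Σ< m (λ i → f i + g i) ≈ Σ< m f + Σ< m g
  sumBelow-+ zero    f g = sym (+-identityˡ 0#)
  sumBelow-+ (suc m) f g = trans (+-congʳ (sumBelow-+ m f g))
    (solve 4 (λ a b c d → (a :+ b) :+ (c :+ d) := (a :+ c) :+ (b :+ d)) refl _ _ _ _)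

  sumBelow-*ˡ : ∀ m a (f : ℕ → Carrier) → Σ< m (λ i → a * f i) ≈ a * Σ< m f
  sumBelow-*ˡ zero    a f = sym (zeroʳ a)
  sumBelow-*ˡ (suc m) a f = trans (+-congʳ (sumBelow-*ˡ m a f)) (sym (distribˡ a _ _))

  sumBelow-suc-head : ∀ m (f : ℕ → Carrier) → Σ< (suc m) f ≈ f 0 + Σ< m (λ i → f (suc i))
  sumBelow-suc-head zero    f = trans (+-identityˡ _) (sym (+-identityʳ _))
  sumBelow-suc-head (suc m) f = trans (+-congʳ (sumBelow-suc-head m f)) (+-assoc _ _ _)

  sumBelow-reverse : ∀ n (f : ℕ → Carrier) → Σ< (suc n) f ≈ Σ< (suc n) (λ k → f (n ∸ k))
  sumBelow-reverse zero    f = refl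
  sumBelow-reverse (suc n) f = begin
    Σ< (suc n) f + f (suc n)                 ≈⟨ +-congʳ (sumBelow-reverse n f) ⟩
    Σ< (suc n) (λ k → f (n ∸ k)) + f (suc n) ≈⟨ +-comm _ _ ⟩
    f (suc n) + Σ< (suc n) (λ k → f (n ∸ k)) ≈⟨ sumBelow-suc-head (suc n) (λ k → f (suc n ∸ k)) ⟨
    Σ< (suc (suc n)) (λ k → f (suc n ∸ k))   ∎

  [1-x]*w≈w-x*w : ∀ x w → (1# - x) * w ≈ w - x * w
  [1-x]*w≈w-x*w x w = trans (distribʳ w 1# (- x))
    (+-cong (*-identityˡ w) (sym (-‿distribˡ-* x w)))

  module _ (x : Carrier) where

    ascendingTerm : ℕ → ℕ → Carrier
    ascendingTerm n m = ι R (n C ⌊ m /2⌋) * x ^ m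

    P≈ascending : ∀ n → P R n x ≈ Σ< (suc n) (ascendingTerm n)
    P≈ascending n = trans
      (sumBelow-cong (suc n) (λ k → reflexive
        (cong (λ i → ι R (n C i) * x ^ (n ∸ k)) (n/2≡⌊n/2⌋ (n ∸ k)))))
      (sym (sumBelow-reverse n (ascendingTerm n)))

    shiftedTerm : ℕ → ℕ → Carrier
    shiftedTerm n zero          = 0#
    shiftedTerm n (suc zero)    = 0#
    shiftedTerm n (suc (suc m)) = x * x * ascendingTerm n m

    ascendingTerm-pascal : ∀ n m → ascendingTerm (suc n) m ≈ ascendingTerm n m + shiftedTerm n m
    ascendingTerm-pascal n zero          = sym (+-identityʳ _)
    ascendingTerm-pascal n (suc zero)    = sym (+-identityʳ _)
    ascendingTerm-pascal n (suc (suc m)) = begin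
      ι R (suc n C suc ⌊ m /2⌋) * x ^ suc (suc m)
        ≈⟨ *-congʳ (reflexive (cong (ι R) (≡.sym (nCk+nC[k+1]≡[n+1]C[k+1] n ⌊ m /2⌋)))) ⟩
      ι R (n C ⌊ m /2⌋ +ℕ n C suc ⌊ m /2⌋) * (x * (x * x ^ m))
        ≈⟨ *-congʳ (×-homo-+ 1# (n C ⌊ m /2⌋) (n C suc ⌊ m /2⌋)) ⟩
      (a + b) * (x * (x * x ^ m))
        ≈⟨ solve 4 (λ a b x y → (a :+ b) :* (x :* (x :* y)) := b :* (x :* (x :* y)) :+ x :* x :* (a :* y))
             refl a b x (x ^ m) ⟩
      ascendingTerm n (suc (suc m)) + shiftedTerm n (suc (suc m)) ∎
      where
      a = ι R (n C ⌊ m /2⌋)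
      b = ι R (n C suc ⌊ m /2⌋)

    sumBelow-shiftedTerm : ∀ n → Σ< (suc (suc n)) (shiftedTerm n) ≈ x * x * Σ< n (ascendingTerm n)
    sumBelow-shiftedTerm n = begin
      Σ< (suc (suc n)) (shiftedTerm n)              ≈⟨ sumBelow-suc-head (suc n) (shiftedTerm n) ⟩
      0# + Σ< (suc n) (λ i → shiftedTerm n (suc i)) ≈⟨ +-identityˡ _ ⟩
      Σ< (suc n) (λ i → shiftedTerm n (suc i))      ≈⟨ sumBelow-suc-head n (λ i → shiftedTerm n (suc i)) ⟩
      0# + Σ< n (λ i → x * x * ascendingTerm n i)   ≈⟨ +-identityˡ _ ⟩
      Σ< n (λ i → x * x * ascendingTerm n i)        ≈⟨ sumBelow-*ˡ n (x * x) (ascendingTerm n) ⟩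
      x * x * Σ< n (ascendingTerm n)                ∎

    ascendingTerm-top : ∀ n → ascendingTerm n (suc n) ≈ ι R (n C ⌊ n /2⌋) * x ^ suc n
    ascendingTerm-top n = reflexive (cong (λ i → ι R i * x ^ suc n) (nC⌈n/2⌉≡nC⌊n/2⌋ n))

    P-suc : ∀ n → P R (suc n) x ≈ (1# + x * x) * P R n x + (1# - x) * (ι R (𝓑 n 0) * x ^ suc n)
    P-suc n = begin
      P R (suc n) x
        ≈⟨ P≈ascending (suc n) ⟩
      Σ< (suc (suc n)) (ascendingTerm (suc n))
        ≈⟨ sumBelow-cong (suc (suc n)) (ascendingTerm-pascal n) ⟩
      Σ< (suc (suc n)) (λ m → ascendingTerm n m + shiftedTerm n m)
        ≈⟨ sumBelow-+ (suc (suc n)) (ascendingTerm n) (shiftedTerm n) ⟩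
      (Σ< (suc n) (ascendingTerm n) + ascendingTerm n (suc n)) + Σ< (suc (suc n)) (shiftedTerm n)
        ≈⟨ +-cong (+-congˡ (ascendingTerm-top n)) (sumBelow-shiftedTerm n) ⟩
      ((S + t * y) + t * (x * y)) + x * x * S
        ≈⟨ regroup ⟩
      (1# + x * x) * Σ< (suc n) (ascendingTerm n) + (1# - x) * (t * x ^ suc n)
        ≈⟨ +-cong (*-congˡ (P≈ascending n)) (*-congˡ (*-congʳ 𝓑n0≈t)) ⟨
      (1# + x * x) * P R n x + (1# - x) * (ι R (𝓑 n 0) * x ^ suc n) ∎
      where
      S = Σ< n (ascendingTerm n)
      t = ι R (n C ⌊ n /2⌋)
      y = x ^ n
      𝓑n0≈t : ι R (𝓑 n 0) ≈ t
      𝓑n0≈t = reflexive (cong (λ i → ι R (n C i)) (n/2≡⌊n/2⌋ n))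
      L = ((S + t * y) + t * (x * y)) + x * x * S
      -- Everything but the cancelling pair ±x·(t·x·y) is a semiring identity.
      regroup : L ≈ (1# + x * x) * (S + t * y) + (1# - x) * (t * (x * y))
      regroup = sym (begin
        (1# + x * x) * (S + t * y) + (1# - x) * (t * (x * y))
          ≈⟨ +-congˡ ([1-x]*w≈w-x*w x (t * (x * y))) ⟩
        (1# + x * x) * (S + t * y) + (t * (x * y) - x * (t * (x * y)))
          ≈⟨ solve 5 (λ S t x y n →
               (con 1 :+ x :* x) :* (S :+ t :* y) :+ (t :* (x :* y) :+ n)
               := (((S :+ t :* y) :+ t :* (x :* y)) :+ x :* x :* S) :+ (x :* (t :* (x :* y)) :+ n))
             refl S t x y (- (x * (t * (x * y)))) ⟩
        L + (x * (t * (x * y)) - x * (t * (x * y)))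
          ≈⟨ +-congˡ (-‿inverseʳ _) ⟩
        L + 0#
          ≈⟨ +-identityʳ L ⟩
        L ∎)

    -- d stands for n ∸ k; abstracting it lets the match on ≡.refl go through.
    P-peel : ∀ n k {d m s} → d ≡ suc m →
             P R n x ≈ (1# + x * x) ^ k * P R d x + (1# - x) * s →
             P R n x ≈ (1# + x * x) ^ suc k * P R m x
                       + (1# - x) * (s + ι R (𝓑 (d ∸ 1) 0) * (1# + x * x) ^ k * x ^ d)
    P-peel n k {m = m} {s} ≡.refl Pn≈ = begin
      P R n x ≈⟨ Pn≈ ⟩
      a * P R (suc m) x + w * s ≈⟨ +-congʳ (*-congˡ (P-suc m)) ⟩
      a * (A * P R m x + w * (t * u)) + w * s
        ≈⟨ solve 7 (λ a A p w t u s → a :* (A :* p :+ w :* (t :* u)) :+ w :* s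
                     := (A :* a) :* p :+ w :* (s :+ t :* a :* u))
             refl a A (P R m x) w t u s ⟩
      (A * a) * P R m x + w * (s + t * a * u) ∎
      where
      A = 1# + x * x
      a = A ^ k
      w = 1# - x
      t = ι R (𝓑 m 0)
      u = x ^ suc m

    P-unroll : ∀ n k → k ≤ n →
               P R n x ≈ (1# + x * x) ^ k * P R (n ∸ k) x
                         + (1# - x) * Σ< k (λ j → ι R (𝓑 (n ∸ j ∸ 1) 0) * (1# + x * x) ^ j * x ^ (n ∸ j))
    P-unroll n zero    _   = sym (trans (+-cong (*-identityˡ (P R n x)) (zeroʳ (1# - x))) (+-identityʳ _))
    P-unroll n (suc k) k<n = P-peel n k (n<m⇒m∸n≡1+m∸[1+n] k<n) (P-unroll n k (<⇒≤ k<n))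

theorem3p3 : ∀ {c ℓ : Level} (R : CommutativeRing c ℓ) (n k : ℕ) →
    2 ≤ n → 1 ≤ k → k ≤ n ∸ 1 →
    (x : CommutativeRing.Carrier R) →
    let open CommutativeRing R in
    P R n x ≈
    (pow R (1# + x * x) k * P R (n ∸ k) x
    + (1# - x) * sumBelow R k
    (λ j → ι R (𝓑 (n ∸ j ∸ 1) 0) * pow R (1# + x * x) j * pow R x (n ∸ j)))
theorem3p3 R n k _ _ k≤n∸1 x = P-unroll R x n k (≤-trans k≤n∸1 (m∸n≤m n 1))
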